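{- Let $\mathbf{S}$ be a hereditary closed set of positions of a ruleset. Every position $G\in\mathbf{S}$ is a number if and only if, for every position $G\in\mathbf{S}$, every pair $(G^L,G^R)\in G^{\mathcal{L}}\times G^{\mathcal{R}}$ satisfies the F1 property.
   Context: We work in normal-play combinatorial game theory with short partizan games and the usual partial order $\leqslant$ on game values. For a position $G$, $G^{\mathcal{L}}$ and $G^{\mathcal{R}}$ denote its sets of Left and Right options; for an option $G^L$, $G^{L\mathcal{R}}$ denotes the set of Right options of $G^L$, and for $G^R$, $G^{R\mathcal{L}}$ denotes the set of Left options of $G^R$. A "number" is a game equal to a surreal number (dyadic rational). A set $\mathbf{S}$ of positions is a hereditary closed set of positions of a ruleset (HCR) if it is closed under taking options. For $G\in\mathbf{S}$, a pair $(G^L,G^R)\in G^{\mathcal{L}}\times G^{\mathcal{R}}$ satisfies the F1 property if there is $G^{RL}\in G^{R\mathcal{L}}$ with $G^{RL}\geqslant G^L$, or there is $G^{LR}\in G^{L\mathcal{R}}$ with $G^{LR}\leqslant G^R$. -}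

module Defs where

open import Data.Nat using (ℕ)
open import Data.Fin using (Fin)
open import Data.Product using (Σ; _×_; ∃)
open import Data.Sum using (_⊎_)
open import Relation.Nullary using (¬_)

data Game : Set where
  mk : (nl : ℕ) → (Fin nl → Game) → (nr : ℕ) → (Fin nr → Game) → Game

nL : Game → ℕ
nL (mk nl _ _ _) = nl

nR : Game → ℕ
nR (mk _ _ nr _) = nr

leftOpt : (G : Game) → Fin (nL G) → Game
leftOpt (mk _ L _ _) = L

rightOpt : (G : Game) → Fin (nR G) → Game
rightOpt (mk _ _ _ R) = R

infix 4 _≤G_ _≥G_ _≈G_ _<G_
_≤G_ : Game → Game → Set
mk nl L nr R ≤G mk ml L' mr R' =
  ((i : Fin nl) → ¬ (mk ml L' mr R' ≤G L i)) ×
  ((j : Fin mr) → ¬ (R' j ≤G mk nl L nr R))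

_≥G_ : Game → Game → Set
G ≥G H = H ≤G G

_≈G_ : Game → Game → Set
G ≈G H = (G ≤G H) × (H ≤G G)

_<G_ : Game → Game → Set
G <G H = (G ≤G H) × ¬ (H ≤G G)

IsNumberForm : Game → Set
IsNumberForm (mk nl L nr R) =
  ((i : Fin nl) → IsNumberForm (L i)) ×
  ((j : Fin nr) → IsNumberForm (R j)) ×
  ((i : Fin nl) (j : Fin nr) → L i <G R j)

IsNumber : Game → Set
IsNumber G = Σ Game (λ x → IsNumberForm x × (x ≈G G))

Hereditary : (Game → Set) → Set
Hereditary S = (G : Game) → S G →
  ((i : Fin (nL G)) → S (leftOpt G i)) × ((j : Fin (nR G)) → S (rightOpt G j))

F1 : (G : Game) → Fin (nL G) → Fin (nR G) → Set
F1 G i j =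
  Σ (Fin (nL (rightOpt G j))) (λ k → leftOpt (rightOpt G j) k ≥G leftOpt G i)
  ⊎ Σ (Fin (nR (leftOpt G i))) (λ k → rightOpt (leftOpt G i) k ≤G rightOpt G j)

-- Unfolding the order, the F1 property of (Gᴸ, Gᴿ) says exactly Gᴿ ≰ Gᴸ.
-- If all positions are numbers, totality of numbers turns G ≰ Gᴸ into
-- Gᴸ ≤ G, so Gᴿ ≤ Gᴸ would give Gᴿ ≤ G, which is impossible.  Conversely, by
-- induction every option is equal to a number form; replacing the options by
-- these forms yields an equal game x, and x is a number form because Gᴿ ≰ Gᴸ
-- becomes xᴸ < xᴿ by totality of number forms.
module Submission where

open import Defs
open import Data.Nat using (ℕ)
open import Data.Fin using (Fin)
open import Data.Fin.Properties using (any?)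
open import Data.Product using (_×_; _,_; proj₁; proj₂; Σ)
open import Data.Sum using (_⊎_; inj₁; inj₂)
open import Relation.Nullary using (¬_; Dec; yes; no; contradiction)

≤-intro : (x y : Game) →
  ((i : Fin (nL x)) → ¬ (y ≤G leftOpt x i)) → ((j : Fin (nR y)) → ¬ (rightOpt y j ≤G x)) →
  x ≤G y
≤-intro (mk _ _ _ _) (mk _ _ _ _) noLeft noRight = noLeft , noRight

≤⇒≰leftOpt : (x y : Game) → x ≤G y → (i : Fin (nL x)) → ¬ (y ≤G leftOpt x i)
≤⇒≰leftOpt (mk _ _ _ _) (mk _ _ _ _) = proj₁

≤⇒rightOpt≰ : (x y : Game) → x ≤G y → (j : Fin (nR y)) → ¬ (rightOpt y j ≤G x)
≤⇒rightOpt≰ (mk _ _ _ _) (mk _ _ _ _) = proj₂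

≤-refl : (x : Game) → x ≤G x
≤-refl x@(mk _ L _ R) = ≤-intro x x
  (λ i x≤xᴸ → ≤⇒≰leftOpt x (L i) x≤xᴸ i (≤-refl (L i)))
  (λ j xᴿ≤x → ≤⇒rightOpt≰ (R j) x xᴿ≤x j (≤-refl (R j)))

≤-trans : (x y z : Game) → x ≤G y → y ≤G z → x ≤G z
≤-trans x@(mk _ L _ _) y z@(mk _ _ _ R) x≤y y≤z = ≤-intro x z
  (λ i z≤xᴸ → ≤⇒≰leftOpt x y x≤y i (≤-trans y z (L i) y≤z z≤xᴸ))
  (λ j zᴿ≤x → ≤⇒rightOpt≰ y z y≤z j (≤-trans (R j) x y zᴿ≤x x≤y))

x≰leftOpt : (x : Game) (i : Fin (nL x)) → ¬ (x ≤G leftOpt x i)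
x≰leftOpt x i = ≤⇒≰leftOpt x x (≤-refl x) i

rightOpt≰x : (x : Game) (j : Fin (nR x)) → ¬ (rightOpt x j ≤G x)
rightOpt≰x x j = ≤⇒rightOpt≰ x x (≤-refl x) j

≰-Witness : Game → Game → Set
≰-Witness x y = Σ (Fin (nL x)) (λ i → y ≤G leftOpt x i) ⊎ Σ (Fin (nR y)) (λ j → rightOpt y j ≤G x)

≰-witness⇒≰ : (x y : Game) → ≰-Witness x y → ¬ (x ≤G y)
≰-witness⇒≰ x y (inj₁ (i , y≤xᴸ)) x≤y = ≤⇒≰leftOpt x y x≤y i y≤xᴸ
≰-witness⇒≰ x y (inj₂ (j , yᴿ≤x)) x≤y = ≤⇒rightOpt≰ x y x≤y j yᴿ≤x

-- Constructively, ≰ yields a witness only because ≤ is decidable, options being finite.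
≤-or-≰-witness : (x y : Game) → x ≤G y ⊎ ≰-Witness x y

_≤?_ : (x y : Game) → Dec (x ≤G y)
x ≤? y with ≤-or-≰-witness x y
... | inj₁ x≤y = yes x≤y
... | inj₂ w   = no (≰-witness⇒≰ x y w)

≤-or-≰-witness x@(mk _ L _ _) y@(mk _ _ _ R)
  with any? (λ i → y ≤? L i) | any? (λ j → R j ≤? x)
... | yes w     | _          = inj₂ (inj₁ w)
... | no _      | yes w      = inj₂ (inj₂ w)
... | no noLeft | no noRight =
  inj₁ (≤-intro x y (λ i y≤xᴸ → noLeft (i , y≤xᴸ)) (λ j yᴿ≤x → noRight (j , yᴿ≤x)))

≰⇒≰-witness : (x y : Game) → ¬ (x ≤G y) → ≰-Witness x y
≰⇒≰-witness x y x≰y with ≤-or-≰-witness x y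
... | inj₁ x≤y = contradiction x≤y x≰y
... | inj₂ w   = w

F1⇔rightOpt≰leftOpt : (G : Game) (i : Fin (nL G)) (j : Fin (nR G)) →
  (F1 G i j → ¬ (rightOpt G j ≤G leftOpt G i)) × (¬ (rightOpt G j ≤G leftOpt G i) → F1 G i j)
F1⇔rightOpt≰leftOpt G i j =
  ≰-witness⇒≰ (rightOpt G j) (leftOpt G i) , ≰⇒≰-witness (rightOpt G j) (leftOpt G i)

leftOpt≤numberForm : (x : Game) → IsNumberForm x → (i : Fin (nL x)) → leftOpt x i ≤G x
leftOpt≤numberForm x@(mk _ L _ _) (numL , _ , L<R) i = ≤-intro (L i) x
  (λ k x≤xᴸᴸ → x≰leftOpt x i
    (≤-trans x (leftOpt (L i) k) (L i) x≤xᴸᴸ (leftOpt≤numberForm (L i) (numL i) k)))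
  (λ j xᴿ≤xᴸ → proj₂ (L<R i j) xᴿ≤xᴸ)

numberForm≤rightOpt : (x : Game) → IsNumberForm x → (j : Fin (nR x)) → x ≤G rightOpt x j
numberForm≤rightOpt x@(mk _ _ _ R) (_ , numR , L<R) j = ≤-intro x (R j)
  (λ i xᴿ≤xᴸ → proj₂ (L<R i j) xᴿ≤xᴸ)
  (λ k xᴿᴿ≤x → rightOpt≰x x j
    (≤-trans (R j) (rightOpt (R j) k) x (numberForm≤rightOpt (R j) (numR j) k) xᴿᴿ≤x))

numberForm-total : (x y : Game) → IsNumberForm x → IsNumberForm y → ¬ (x ≤G y) → y ≤G x
numberForm-total x y numX numY x≰y with ≰⇒≰-witness x y x≰y
... | inj₁ (i , y≤xᴸ) = ≤-trans y (leftOpt x i) x y≤xᴸ (leftOpt≤numberForm x numX i)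
... | inj₂ (j , yᴿ≤x) = ≤-trans y (rightOpt y j) x (numberForm≤rightOpt y numY j) yᴿ≤x

number-total : (x y : Game) → IsNumber x → IsNumber y → ¬ (x ≤G y) → y ≤G x
number-total x y (a , numA , a≤x , x≤a) (b , numB , b≤y , y≤b) x≰y =
  ≤-trans y b x y≤b (≤-trans b a x b≤a a≤x)
  where
  b≤a : b ≤G a
  b≤a = numberForm-total a b numA numB
    (λ a≤b → x≰y (≤-trans x a y x≤a (≤-trans a b y a≤b b≤y)))

numbers⇒rightOpt≰leftOpt : (G : Game) (i : Fin (nL G)) (j : Fin (nR G)) →
  IsNumber G → IsNumber (leftOpt G i) → ¬ (rightOpt G j ≤G leftOpt G i)
numbers⇒rightOpt≰leftOpt G i j numG numGᴸ Gᴿ≤Gᴸ = rightOpt≰x G j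
  (≤-trans (rightOpt G j) (leftOpt G i) G Gᴿ≤Gᴸ
    (number-total G (leftOpt G i) numG numGᴸ (x≰leftOpt G i)))

mk-mono-≤ : (nl : ℕ) (L L′ : Fin nl → Game) (nr : ℕ) (R R′ : Fin nr → Game) →
  ((i : Fin nl) → L i ≤G L′ i) → ((j : Fin nr) → R j ≤G R′ j) →
  mk nl L nr R ≤G mk nl L′ nr R′
mk-mono-≤ nl L L′ nr R R′ L≤L′ R≤R′ =
  (λ i x′≤L → x≰leftOpt x′ i (≤-trans x′ (L i) (L′ i) x′≤L (L≤L′ i))) ,
  (λ j R′≤x → rightOpt≰x x j (≤-trans (R j) (R′ j) x (R≤R′ j) R′≤x))
  where
  x x′ : Game
  x  = mk nl L nr R
  x′ = mk nl L′ nr R′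

mk-cong-≈ : (nl : ℕ) (L L′ : Fin nl → Game) (nr : ℕ) (R R′ : Fin nr → Game) →
  ((i : Fin nl) → L i ≈G L′ i) → ((j : Fin nr) → R j ≈G R′ j) →
  mk nl L nr R ≈G mk nl L′ nr R′
mk-cong-≈ nl L L′ nr R R′ L≈L′ R≈R′ =
  mk-mono-≤ nl L L′ nr R R′ (λ i → proj₁ (L≈L′ i)) (λ j → proj₁ (R≈R′ j)) ,
  mk-mono-≤ nl L′ L nr R′ R (λ i → proj₂ (L≈L′ i)) (λ j → proj₂ (R≈R′ j))

number-of-options : (G : Game) →
  ((i : Fin (nL G)) → IsNumber (leftOpt G i)) → ((j : Fin (nR G)) → IsNumber (rightOpt G j)) →
  ((i : Fin (nL G)) (j : Fin (nR G)) → ¬ (rightOpt G j ≤G leftOpt G i)) →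
  IsNumber G
number-of-options (mk nl L nr R) numL numR Rᴶ≰Lᴵ =
  x , (numXL , numXR , XL<XR) , mk-cong-≈ nl XL L nr XR R XL≈L XR≈R
  where
  XL : Fin nl → Game
  XL i = proj₁ (numL i)
  XR : Fin nr → Game
  XR j = proj₁ (numR j)
  x : Game
  x = mk nl XL nr XR
  numXL : (i : Fin nl) → IsNumberForm (XL i)
  numXL i = proj₁ (proj₂ (numL i))
  numXR : (j : Fin nr) → IsNumberForm (XR j)
  numXR j = proj₁ (proj₂ (numR j))
  XL≈L : (i : Fin nl) → XL i ≈G L i
  XL≈L i = proj₂ (proj₂ (numL i))
  XR≈R : (j : Fin nr) → XR j ≈G R j
  XR≈R j = proj₂ (proj₂ (numR j))
  XR≰XL : (i : Fin nl) (j : Fin nr) → ¬ (XR j ≤G XL i)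
  XR≰XL i j XR≤XL = Rᴶ≰Lᴵ i j
    (≤-trans (R j) (XR j) (L i) (proj₂ (XR≈R j)) (≤-trans (XR j) (XL i) (L i) XR≤XL (proj₁ (XL≈L i))))
  XL<XR : (i : Fin nl) (j : Fin nr) → XL i <G XR j
  XL<XR i j = numberForm-total (XR j) (XL i) (numXR j) (numXL i) (XR≰XL i j) , XR≰XL i j

mainTheorem4 : (S : Game → Set) → Hereditary S →
    (((G : Game) → S G → IsNumber G) →
       ((G : Game) → S G → (i : Fin (nL G)) (j : Fin (nR G)) → F1 G i j))
    × (((G : Game) → S G → (i : Fin (nL G)) (j : Fin (nR G)) → F1 G i j) →
       ((G : Game) → S G → IsNumber G))
mainTheorem4 S hereditary = allNumbers⇒allF1 , allF1⇒allNumbers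
  where
  AllNumbers AllF1 : Set
  AllNumbers = (G : Game) → S G → IsNumber G
  AllF1 = (G : Game) → S G → (i : Fin (nL G)) (j : Fin (nR G)) → F1 G i j

  allNumbers⇒allF1 : AllNumbers → AllF1
  allNumbers⇒allF1 number G sG i j = proj₂ (F1⇔rightOpt≰leftOpt G i j)
    (numbers⇒rightOpt≰leftOpt G i j (number G sG) (number (leftOpt G i) (proj₁ (hereditary G sG) i)))

  allF1⇒allNumbers : AllF1 → AllNumbers
  allF1⇒allNumbers f1 G@(mk _ L _ R) sG = number-of-options G
    (λ i → allF1⇒allNumbers f1 (L i) (proj₁ (hereditary G sG) i))
    (λ j → allF1⇒allNumbers f1 (R j) (proj₂ (hereditary G sG) j))
    (λ i j → proj₁ (F1⇔rightOpt≰leftOpt G i j) (f1 G sG i j))
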